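{- Consider Algorithm 1 (described in the context) with IDs that are not necessarily unique, and let $V_{\max}=\{v:\mathrm{ID}(v)=\mathrm{ID}_{\max}\}$. If at some point $\rho_{cw}(v)\ge\mathrm{ID}(v)$ for all $v\in V_{\max}$, then $\rho_{cw}(v)\ge\mathrm{ID}(v)$ holds for every node $v$ at this point. That is, one of the nodes in $V_{\max}$ is the last node to satisfy $\rho_{cw}(v)\ge\mathrm{ID}(v)$.
   Context: Oriented ring of $n$ nodes, content-oblivious asynchronous model (content-free pulses, delivered after arbitrary finite delays, never lost or injected; each node has an incoming queue per port). Each node $v$ has a positive integer ID $\mathrm{ID}(v)$ (not necessarily distinct); $\mathrm{ID}_{\max}=\max_v\mathrm{ID}(v)$. $\rho_{cw}(v)$ and $\sigma_{cw}(v)$ are the numbers of clockwise (CW) pulses node $v$ has received (consumed from its queue) and sent, initially 0. Algorithm 1 at node $v$: first send one CW pulse; then loop forever: if a CW pulse is waiting, consume it (incrementing $\rho_{cw}(v)$); then if $\rho_{cw}(v)=\mathrm{ID}(v)$ set state to Leader and send nothing, otherwise set state to Non-Leader and send one CW pulse. Times are considered at ends of loop iterations. -}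

module Defs where

open import Data.Nat using (ℕ; zero; suc; _+_; _≤_; _<_; _⊔_)
open import Data.Bool using (Bool; true; false; if_then_else_)
open import Data.Fin using (Fin; zero; suc; fromℕ; inject₁; _≟_)
open import Data.List using (List; foldr; map; allFin)
open import Relation.Nullary using (¬_)
open import Relation.Nullary.Decidable using (⌊_⌋)
open import Relation.Binary.PropositionalEquality using (_≡_)

-- Oriented ring with  n = suc m  nodes, named 0 … m.  A clockwise (CW)
-- pulse sent by node v travels to node  succ v ; hence node v receives
-- its CW pulses from  pred v .
pred : ∀ {m} → Fin (suc m) → Fin (suc m)
pred {m} zero = fromℕ m
pred (suc i) = inject₁ i

IDmax : ∀ {m} → (Fin (suc m) → ℕ) → ℕ
IDmax {m} ID = foldr _⊔_ 0 (map ID (allFin (suc m)))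

upd : ∀ {m} {A : Set} → (Fin (suc m) → A) → Fin (suc m) → A → Fin (suc m) → A
upd f v x u = if ⌊ u ≟ v ⌋ then x else f u

-- Global configuration of the asynchronous system.
--   started v : v has executed its initial CW send
--   rho v     : ρ_cw(v), CW pulses consumed by v
--   sigma v   : σ_cw(v), CW pulses sent by v
--   dlv v     : CW pulses delivered into v's incoming CW queue
--               (so the queue holds  dlv v ∸ rho v  pulses, and
--                sigma (pred v) ∸ dlv v  pulses are still in transit)
record Config (m : ℕ) : Set where
  constructor cfg
  field
    started : Fin (suc m) → Bool
    rho     : Fin (suc m) → ℕ
    sigma   : Fin (suc m) → ℕ
    dlv     : Fin (suc m) → ℕ
open Config public

initConfig : ∀ {m} → Config m
initConfig = cfg (λ _ → false) (λ _ → 0) (λ _ → 0) (λ _ → 0)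

data Step {m : ℕ} (ID : Fin (suc m) → ℕ) : Config m → Config m → Set where
  start   : ∀ {s r σ d} v → s v ≡ false →
            Step ID (cfg s r σ d) (cfg (upd s v true) r (upd σ v (suc (σ v))) d)
  -- the adversary delivers one in-transit CW pulse (sent by pred v) to v's queue
  deliver : ∀ {s r σ d} v → d v < σ (pred v) →
            Step ID (cfg s r σ d) (cfg s r σ (upd d v (suc (d v))))
  -- one loop iteration of v consuming a waiting CW pulse; ρ becomes ID v:
  -- v becomes Leader and sends nothing
  iterLeader    : ∀ {s r σ d} v → s v ≡ true → r v < d v → suc (r v) ≡ ID v →
            Step ID (cfg s r σ d) (cfg s (upd r v (suc (r v))) σ d)
  -- one loop iteration of v consuming a waiting CW pulse; ρ ≠ ID v:
  -- v becomes Non-Leader and sends one CW pulse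
  iterNonLeader : ∀ {s r σ d} v → s v ≡ true → r v < d v → ¬ (suc (r v) ≡ ID v) →
            Step ID (cfg s r σ d) (cfg s (upd r v (suc (r v))) (upd σ v (suc (σ v))) d)
-- (A loop iteration in which no CW pulse is waiting changes nothing.)

data Reachable {m : ℕ} (ID : Fin (suc m) → ℕ) : Config m → Set where
  here : Reachable ID initConfig
  next : ∀ {c c'} → Reachable ID c → Step ID c c' → Reachable ID c'

-- Every pulse a node consumes was sent by its predecessor, and a node that has
-- consumed ρ pulses has sent at most max(ρ, ID) of them: one initial pulse and
-- one per consumed pulse, except the pulse that makes ρ equal to its ID.
-- Hence if a node p has ρ(p) < IDmax and ID(p) < IDmax, its successor also has
-- ρ < IDmax. When all of V_max are done, every node with ρ < IDmax lies outside
-- V_max, so a node with ρ(v) < ID(v) ≤ IDmax would spread ρ < IDmax clockwise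
-- around the whole ring, in particular to V_max.
module Submission where

open import Defs
open import Data.Bool using (Bool; true; false)
open import Data.Fin using (Fin; zero; suc; _≟_)
open import Data.Fin.Induction using (<-weakInduction; <-weakInduction-startingFrom)
open import Data.Fin.Properties using (≤fromℕ)
open import Data.List using (map; allFin)
open import Data.List.Properties using (foldr-preservesᵒ)
open import Data.List.Membership.Propositional using (lose)
open import Data.List.Membership.Propositional.Properties
  using (∈-allFin; ∈-map⁺; ∈-map⁻; foldr-selective)
open import Data.Nat using (ℕ; suc; _≤_; _<_; _⊔_; z≤n; _≤?_)
open import Data.Nat.Properties hiding (_≟_)
open import Data.Product using (∃; _,_)
open import Data.Sum using (_⊎_; inj₁; inj₂; [_,_])
open import Level using (Level)
open import Relation.Nullary using (yes; no; contradiction)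
open import Relation.Unary using (Pred)
open import Relation.Binary.PropositionalEquality using (_≡_; _≢_; refl; sym; trans; subst)

private
  variable
    ℓ : Level
    m : ℕ
    ID : Fin (suc m) → ℕ
    c c' : Config m

ring-induction : (P : Pred (Fin (suc m)) ℓ) → (∀ w → P (pred w) → P w) →
                 ∀ {v} → P v → ∀ w → P w
ring-induction P step {v} Pv = <-weakInduction P P-zero (λ i → step (suc i))
  where
  P-zero : P zero
  P-zero = step zero (<-weakInduction-startingFrom P Pv (λ i → step (suc i)) (≤fromℕ v))

≤-IDmax : (ID : Fin (suc m) → ℕ) (v : Fin (suc m)) → ID v ≤ IDmax ID
≤-IDmax ID v = foldr-preservesᵒ ≤-⊔ 0 _ (inj₂ (lose (∈-map⁺ ID (∈-allFin v)) ≤-refl))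
  where
  ≤-⊔ : ∀ x y → ID v ≤ x ⊎ ID v ≤ y → ID v ≤ x ⊔ y
  ≤-⊔ x y = [ m≤n⇒m≤n⊔o y , m≤n⇒m≤o⊔n x ]

IDmax-attained : (ID : Fin (suc m) → ℕ) → ∃ λ u → ID u ≡ IDmax ID
IDmax-attained ID with foldr-selective ⊔-sel 0 (map ID (allFin _))
... | inj₁ IDmax≡0 = zero , trans (n≤0⇒n≡0 (subst (ID zero ≤_) IDmax≡0 (≤-IDmax ID zero))) (sym IDmax≡0)
... | inj₂ IDmax∈IDs with ∈-map⁻ ID IDmax∈IDs
...   | u , _ , IDmax≡IDu = u , sym IDmax≡IDu

≤-upd-suc : (f : Fin (suc m) → ℕ) (v u : Fin (suc m)) → f u ≤ upd f v (suc (f v)) u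
≤-upd-suc f v u with u ≟ v
... | yes refl = n≤1+n (f u)
... | no _ = ≤-refl

reachable-invariant : (P : Config m → Set ℓ) → P initConfig →
                      (∀ {c c'} → Step ID c c' → P c → P c') →
                      Reachable ID c → P c
reachable-invariant P init step here = init
reachable-invariant P init step (next r s) = step s (reachable-invariant P init step r)

rho≤dlv-step : Step ID c c' → (∀ w → rho c w ≤ dlv c w) → ∀ w → rho c' w ≤ dlv c' w
rho≤dlv-step (start _ _) inv = inv
rho≤dlv-step (deliver {d = d} v _) inv w = ≤-trans (inv w) (≤-upd-suc d v w)
rho≤dlv-step (iterLeader v _ r<d _) inv w with w ≟ v
... | yes refl = r<d
... | no _ = inv w
rho≤dlv-step (iterNonLeader v _ r<d _) inv w with w ≟ v
... | yes refl = r<d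
... | no _ = inv w

dlv≤sigma-pred-step : Step ID c c' → (∀ w → dlv c w ≤ sigma c (pred w)) →
                      ∀ w → dlv c' w ≤ sigma c' (pred w)
dlv≤sigma-pred-step (start {σ = σ} v _) inv w = ≤-trans (inv w) (≤-upd-suc σ v (pred w))
dlv≤sigma-pred-step (deliver v d<σ) inv w with w ≟ v
... | yes refl = d<σ
... | no _ = inv w
dlv≤sigma-pred-step (iterLeader _ _ _ _) inv = inv
dlv≤sigma-pred-step (iterNonLeader {σ = σ} v _ _ _) inv w = ≤-trans (inv w) (≤-upd-suc σ v (pred w))

rho≤dlv : Reachable ID c → ∀ w → rho c w ≤ dlv c w
rho≤dlv = reachable-invariant (λ c → ∀ w → rho c w ≤ dlv c w) (λ _ → z≤n) rho≤dlv-step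

dlv≤sigma-pred : Reachable ID c → ∀ w → dlv c w ≤ sigma c (pred w)
dlv≤sigma-pred =
  reachable-invariant (λ c → ∀ w → dlv c w ≤ sigma c (pred w)) (λ _ → z≤n) dlv≤sigma-pred-step

rho≤sigma-pred : Reachable ID c → ∀ w → rho c w ≤ sigma c (pred w)
rho≤sigma-pred r w = ≤-trans (rho≤dlv r w) (dlv≤sigma-pred r w)

-- The (started, ρ_cw, σ_cw) a node with ID id can be in; the pulse bringing ρ_cw to id is
-- the one it swallows as Leader.
data SendCount (id : ℕ) : Bool → ℕ → ℕ → Set where
  idle      : SendCount id false 0 0
  relaying  : ∀ {ρ} → ρ < id → SendCount id true ρ (suc ρ)
  swallowed : ∀ {ρ} → id ≤ ρ → SendCount id true ρ ρ

module _ {id : ℕ} {b : Bool} {ρ σ : ℕ} where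

  SendCount-start : 1 ≤ id → b ≡ false → SendCount id b ρ σ → SendCount id true ρ (suc σ)
  SendCount-start 1≤id refl idle = relaying 1≤id

  SendCount-leader : b ≡ true → suc ρ ≡ id → SendCount id b ρ σ → SendCount id b (suc ρ) σ
  SendCount-leader refl refl (relaying _) = swallowed ≤-refl
  SendCount-leader refl refl (swallowed 1+ρ≤ρ) = contradiction 1+ρ≤ρ (1+n≰n)

  SendCount-nonLeader : b ≡ true → suc ρ ≢ id → SendCount id b ρ σ →
                        SendCount id b (suc ρ) (suc σ)
  SendCount-nonLeader refl 1+ρ≢id (relaying ρ<id) = relaying (≤∧≢⇒< ρ<id 1+ρ≢id)
  SendCount-nonLeader refl _ (swallowed id≤ρ) = swallowed (m≤n⇒m≤1+n id≤ρ)

  sigma≤rho⊔id : SendCount id b ρ σ → σ ≤ ρ ⊔ id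
  sigma≤rho⊔id idle = z≤n
  sigma≤rho⊔id (relaying ρ<id) = m≤n⇒m≤o⊔n ρ ρ<id
  sigma≤rho⊔id (swallowed _) = m≤m⊔n ρ id

NodeSendCount : (Fin (suc m) → ℕ) → Config m → Fin (suc m) → Set
NodeSendCount ID c w = SendCount (ID w) (started c w) (rho c w) (sigma c w)

sendCount-step : (∀ v → 1 ≤ ID v) → Step ID c c' →
                 (∀ w → NodeSendCount ID c w) → ∀ w → NodeSendCount ID c' w
sendCount-step pos (start v s≡false) inv w with w ≟ v
... | yes refl = SendCount-start (pos v) s≡false (inv v)
... | no _ = inv w
sendCount-step pos (deliver _ _) inv = inv
sendCount-step pos (iterLeader v s≡true _ 1+r≡id) inv w with w ≟ v
... | yes refl = SendCount-leader s≡true 1+r≡id (inv v)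
... | no _ = inv w
sendCount-step pos (iterNonLeader v s≡true _ 1+r≢id) inv w with w ≟ v
... | yes refl = SendCount-nonLeader s≡true 1+r≢id (inv v)
... | no _ = inv w

sendCount : (∀ v → 1 ≤ ID v) → Reachable ID c → ∀ w → NodeSendCount ID c w
sendCount {ID = ID} pos =
  reachable-invariant (λ c → ∀ w → NodeSendCount ID c w) (λ _ → idle) (sendCount-step pos)

rho<-propagates : (∀ v → 1 ≤ ID v) → Reachable ID c → ∀ {b} w →
                  rho c (pred w) < b → ID (pred w) < b → rho c w < b
rho<-propagates pos r w ρ<b id<b =
  ≤-<-trans (rho≤sigma-pred r w)
            (≤-<-trans (sigma≤rho⊔id (sendCount pos r (pred w))) (⊔-lub ρ<b id<b))

lemma4p3 : (m : ℕ) (ID : Fin (suc m) → ℕ) → (∀ v → 1 ≤ ID v) →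
           (c : Config m) → Reachable ID c →
           (∀ v → ID v ≡ IDmax ID → ID v ≤ rho c v) →
           ∀ v → ID v ≤ rho c v
lemma4p3 _ ID pos c r maxDone v with ID v ≤? rho c v
... | yes done = done
... | no pending with IDmax-attained ID
...   | u , IDu≡M = contradiction (subst (_≤ rho c u) IDu≡M (maxDone u IDu≡M)) (<⇒≱ (allBelow u))
  where
  M : ℕ
  M = IDmax ID

  outsideVmax : ∀ w → rho c w < M → ID w < M
  outsideVmax w ρ<M = ≤∧≢⇒< (≤-IDmax ID w)
    (λ IDw≡M → <⇒≱ ρ<M (subst (_≤ rho c w) IDw≡M (maxDone w IDw≡M)))

  allBelow : ∀ w → rho c w < M
  allBelow = ring-induction (λ w → rho c w < M)
               (λ w ρ<M → rho<-propagates pos r w ρ<M (outsideVmax (pred w) ρ<M))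
               (<-≤-trans (≰⇒> pending) (≤-IDmax ID v))
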